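{- Let $k$ be a positive integer and let $A=\{a\in\mathbb{N}: a\leq k,\ \binom{k}{a}\equiv 1\pmod 2\}$. Then for every positive integer $n$, $$\tau_k(n+1)\equiv F_A(n)\pmod 2.$$
   Context: For a nonzero integer $k$, the arithmetical function $\tau_k$ is defined by $q\prod_{m=1}^{\infty}(1-q^m)^k=\sum_{n=1}^{\infty}\tau_k(n)q^n$. For a set $A$ of positive integers, $F_A(n)$ denotes the number of partitions of $n$ all of whose frequencies lie in $A$, where the frequency of a part is the number of times that part occurs in the partition. -}

module Defs where

open import Data.Nat as ℕ using (ℕ; zero; suc; _≤_; _≤?_; _∸_; _⊓_)
open import Data.Nat.Combinatorics using (_C_)
open import Data.Nat.DivMod using (_%_)
open import Data.Nat.Properties using (_≟_)
open import Data.Integer as ℤ using (ℤ; +_; -_)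
open import Data.List using (List; []; _∷_; map; concatMap; filter; length)
open import Data.List.Relation.Unary.All using (All; all?)
open import Data.Product using (_×_)
open import Relation.Nullary using (Dec; yes; no; _×-dec_)
open import Relation.Binary.PropositionalEquality using (_≡_)

Series : Set
Series = ℕ → ℤ

sumTo : ℕ → (ℕ → ℤ) → ℤ
sumTo zero    f = f 0
sumTo (suc n) f = sumTo n f ℤ.+ f (suc n)

_⊛_ : Series → Series → Series
(f ⊛ g) n = sumTo n (λ i → f i ℤ.* g (n ∸ i))

oneS : Series
oneS zero    = + 1
oneS (suc _) = + 0

_^S_ : Series → ℕ → Series
f ^S zero  = oneS
f ^S suc k = f ⊛ (f ^S k)

-- the polynomial 1 - q^m  (used for m ≥ 1)
oneMinusQ : ℕ → Series
oneMinusQ m n with n ≟ 0 | n ≟ m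
... | yes _ | _     = + 1
... | no _  | yes _ = - (+ 1)
... | no _  | no _  = + 0

prodUpTo : ℕ → ℕ → Series
prodUpTo k zero    = oneS
prodUpTo k (suc N) = prodUpTo k N ⊛ (oneMinusQ (suc N) ^S k)

-- τ_k(n) = coefficient of q^n in q ∏_{m≥1} (1 - q^m)^k.
-- The coefficient of q^(n) in ∏_{m≥1}(1-q^m)^k only involves factors
-- with m ≤ n, so the finite product ∏_{m=1}^{n} gives it exactly.
tau : ℕ → ℕ → ℤ
tau k zero    = + 0
tau k (suc n) = prodUpTo k n n

freq : ℕ → List ℕ → ℕ
freq x []       = 0
freq x (y ∷ ys) with x ≟ y
... | yes _ = suc (freq x ys)
... | no _  = freq x ys

range1 : ℕ → List ℕ
range1 zero    = []
range1 (suc m) = range1 m Data.List.++ (suc m ∷ [])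

-- all partitions of n with largest part ≤ m, as nonincreasing lists of
-- positive integers (fuel f ≥ n guarantees termination)
partsBounded : ℕ → ℕ → ℕ → List (List ℕ)
partsBounded f       zero    m = [] ∷ []
partsBounded zero    (suc n) m = []
partsBounded (suc f) (suc n) m =
  concatMap (λ p → map (p ∷_) (partsBounded f (suc n ∸ p) p)) (range1 (m ⊓ suc n))

partitions : ℕ → List (List ℕ)
partitions n = partsBounded n n n

InA : ℕ → ℕ → Set
InA k a = (a ≤ k) × ((k C a) % 2 ≡ 1)

inA? : (k a : ℕ) → Dec (InA k a)
inA? k a = (a ≤? k) ×-dec ((k C a) % 2 ≟ 1)

FreqsIn : ℕ → List ℕ → Set
FreqsIn k λs = All (λ x → InA k (freq x λs)) λs

freqsIn? : (k : ℕ) (λs : List ℕ) → Dec (FreqsIn k λs)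
freqsIn? k λs = all? (λ x → inA? k (freq x λs)) λs

F : ℕ → ℕ → ℕ
F k n = length (filter (freqsIn? k) (partitions n))

-- Modulo 2, 1 − q^m ≡ 1 + q^m, so (1 − q^m)^k ≡ Σ_a C(k,a) q^(m a) ≡ Σ_{a ∈ A} q^(m a), and
-- q ∏ (1 − q^m)^k agrees coefficientwise mod 2 with q ∏_m Σ_{a ∈ A} q^(m a). As 0 ∈ A, this
-- product counts the partitions with all frequencies in A: its m-th factor chooses how often m
-- occurs. The enumeration lists parts in nonincreasing order, so it is counted by peeling off the
-- run of largest parts: a prefix ending in c copies of N + 1 has as many completions as the
-- coefficient of ∏_{m ≤ N} Σ_{a ∈ A} q^(m a) · Σ_{c + a ∈ A} q^((N + 1) a).
module Submission where

open import Defs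
open import Data.Nat using (ℕ; _≤_)
open import Data.Integer using (+_; _-_)
open import Data.Integer.Divisibility using (_∣_)

open import Level using (0ℓ)
open import Relation.Unary using (Pred; Decidable)
open import Function using (_∘_; _⇔_; mk⇔; Equivalence)
open import Data.Bool using (true; false; if_then_else_)
open import Data.Product using (_×_; _,_; proj₁; proj₂)
open import Data.Nat as ℕ using (zero; suc; _⊓_; _<_; _∸_; _≡ᵇ_; z≤n; s≤s; NonZero)
import Data.Nat.Properties as ℕ
open import Data.Nat.DivMod using (_%_; _/_; [m+n]%n≡m%n; m<n⇒m%n≡m; m/n≡1+[m∸n]/n; m≡m%n+[m/n]*n; m%n<n)
open import Data.Nat.Combinatorics using (_C_; k>n⇒nCk≡0; nCk+nC[k+1]≡[n+1]C[k+1])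
open import Data.Integer as ℤ using (ℤ; -_; _+_; _*_; 0ℤ; 1ℤ; -1ℤ)
import Data.Integer.Properties as ℤ
import Data.Integer.Divisibility.Signed as Signed
open import Data.Integer.Tactic.RingSolver using (solve-∀)
open import Relation.Nullary using (Dec; yes; no; does; contradiction)
import Relation.Binary.Reasoning.Setoid
open import Data.List using (List; []; _∷_; _++_; map; concatMap; filter; length; replicate)
open import Data.List.Properties using (filter-++; length-++; filter-≐; ++-assoc; ++-identityʳ; concatMap-++)
open import Data.List.Membership.Propositional using (_∈_; _∉_)
open import Data.List.Relation.Unary.Any using (here; there)
open import Data.List.Relation.Unary.All as All using (All; all?)
import Data.List.Relation.Unary.All.Properties as All
open import Data.List.Membership.DecPropositional ℕ._≟_ using (_∈?_)
open import Relation.Binary using (Setoid)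
open import Relation.Binary.PropositionalEquality
  using (_≡_; _≢_; _≗_; refl; sym; trans; cong; cong₂; subst; module ≡-Reasoning)

𝟙 : ∀ {a} {A : Set a} → Dec A → ℤ
𝟙 (yes _) = 1ℤ
𝟙 (no _)  = 0ℤ

𝟙-yes : ∀ {a} {A : Set a} → A → (a? : Dec A) → 𝟙 a? ≡ 1ℤ
𝟙-yes a (yes _) = refl
𝟙-yes a (no ¬a) = contradiction a ¬a

𝟙-× : ∀ {A B C : Set} → A ⇔ (B × C) → (a : Dec A) (b : Dec B) (c : Dec C) → 𝟙 a ≡ 𝟙 b * 𝟙 c
𝟙-× A⇔B×C (yes a) (yes _) (yes _) = refl
𝟙-× A⇔B×C (yes a) (no ¬b) _       = contradiction (proj₁ (Equivalence.to A⇔B×C a)) ¬b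
𝟙-× A⇔B×C (yes a) (yes _) (no ¬c) = contradiction (proj₂ (Equivalence.to A⇔B×C a)) ¬c
𝟙-× A⇔B×C (no ¬a) (yes b) (yes c) = contradiction (Equivalence.from A⇔B×C (b , c)) ¬a
𝟙-× A⇔B×C (no ¬a) (yes _) (no _)  = refl
𝟙-× A⇔B×C (no ¬a) (no _)  _       = refl

-- Congruence modulo 2

-- A record rather than a definition, so that x and y can be inferred from a proof of x ≡₂ y.
infix 4 _≡₂_
record _≡₂_ (x y : ℤ) : Set where
  constructor evenDifference
  field 2∣x-y : + 2 Signed.∣ x - y
open _≡₂_ public

≡₂-intro : ∀ {x y} t → x ≡ y + t * + 2 → x ≡₂ y
≡₂-intro {y = y} t refl = evenDifference (Signed.divides t (cancel y t))
  where cancel : ∀ y t → y + t * + 2 - y ≡ t * + 2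
        cancel = solve-∀

≡⇒≡₂ : ∀ {x y} → x ≡ y → x ≡₂ y
≡⇒≡₂ {y = y} refl = ≡₂-intro 0ℤ (sym (ℤ.+-identityʳ y))

≡₂-refl : ∀ {x} → x ≡₂ x
≡₂-refl = ≡⇒≡₂ refl

≡₂-sym : ∀ {x y} → x ≡₂ y → y ≡₂ x
≡₂-sym {x} {y} (evenDifference 2∣x-y) = evenDifference (subst (+ 2 Signed.∣_) (flip x y) (Signed.∣m⇒∣-m 2∣x-y))
  where flip : ∀ x y → - (x - y) ≡ y - x
        flip = solve-∀

≡₂-trans : ∀ {x y z} → x ≡₂ y → y ≡₂ z → x ≡₂ z
≡₂-trans {x} {y} {z} (evenDifference 2∣x-y) (evenDifference 2∣y-z) =
  evenDifference (subst (+ 2 Signed.∣_) (telescope x y z) (Signed.∣m∣n⇒∣m+n 2∣x-y 2∣y-z))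
  where telescope : ∀ x y z → (x - y) + (y - z) ≡ x - z
        telescope = solve-∀

≡₂-setoid : Setoid 0ℓ 0ℓ
≡₂-setoid = record
  { Carrier = ℤ ; _≈_ = _≡₂_
  ; isEquivalence = record { refl = ≡₂-refl ; sym = ≡₂-sym ; trans = ≡₂-trans } }

module ≡₂-Reasoning = Relation.Binary.Reasoning.Setoid ≡₂-setoid

+-cong₂ : ∀ {x y u v} → x ≡₂ y → u ≡₂ v → x + u ≡₂ y + v
+-cong₂ {x} {y} {u} {v} (evenDifference 2∣x-y) (evenDifference 2∣u-v) =
  evenDifference (subst (+ 2 Signed.∣_) (regroup x y u v) (Signed.∣m∣n⇒∣m+n 2∣x-y 2∣u-v))
  where regroup : ∀ x y u v → (x - y) + (u - v) ≡ (x + u) - (y + v)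
        regroup = solve-∀

*-cong₂ : ∀ {x y u v} → x ≡₂ y → u ≡₂ v → x * u ≡₂ y * v
*-cong₂ {x} {y} {u} {v} (evenDifference 2∣x-y) (evenDifference 2∣u-v) = evenDifference
  (subst (+ 2 Signed.∣_) (regroup x y u v) (Signed.∣m∣n⇒∣m+n (Signed.∣m⇒∣m*n u 2∣x-y) (Signed.∣n⇒∣m*n y 2∣u-v)))
  where regroup : ∀ x y u v → (x - y) * u + y * (u - v) ≡ x * u - y * v
        regroup = solve-∀

-≡₂+ : ∀ x y → x - y ≡₂ x + y
-≡₂+ x y = ≡₂-intro (- y) (regroup x y)
  where regroup : ∀ x y → x - y ≡ x + y + - y * + 2
        regroup = solve-∀

≡₂-%2 : ∀ n → + n ≡₂ + (n % 2)
≡₂-%2 n = ≡₂-intro (+ (n / 2)) (begin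
  + n                              ≡⟨ cong +_ (m≡m%n+[m/n]*n n 2) ⟩
  + (n % 2 ℕ.+ n / 2 ℕ.* 2)        ≡⟨ ℤ.pos-+ (n % 2) (n / 2 ℕ.* 2) ⟩
  + (n % 2) + + (n / 2 ℕ.* 2)      ≡⟨ cong (λ z → + (n % 2) + z) (ℤ.pos-* (n / 2) 2) ⟩
  + (n % 2) + + (n / 2) * + 2      ∎)
  where open ≡-Reasoning

-- Finite sums and Cauchy products

sumTo-cong : ∀ n {f g : ℕ → ℤ} → (∀ i → i ≤ n → f i ≡ g i) → sumTo n f ≡ sumTo n g
sumTo-cong zero    f≡g = f≡g 0 z≤n
sumTo-cong (suc n) f≡g = cong₂ _+_ (sumTo-cong n (λ i i≤n → f≡g i (ℕ.m≤n⇒m≤1+n i≤n))) (f≡g (suc n) ℕ.≤-refl)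

sumTo-cong₂ : ∀ n {f g : ℕ → ℤ} → (∀ i → f i ≡₂ g i) → sumTo n f ≡₂ sumTo n g
sumTo-cong₂ zero    f≡₂g = f≡₂g 0
sumTo-cong₂ (suc n) f≡₂g = +-cong₂ (sumTo-cong₂ n f≡₂g) (f≡₂g (suc n))

sumTo-peel : ∀ n f → sumTo (suc n) f ≡ f 0 + sumTo n (f ∘ suc)
sumTo-peel zero    f = refl
sumTo-peel (suc n) f = trans (cong (_+ f (suc (suc n))) (sumTo-peel n f)) (ℤ.+-assoc (f 0) _ _)

sumTo-last : ∀ n f → (∀ i → i < n → f i ≡ 0ℤ) → sumTo n f ≡ f n
sumTo-last zero    f _   = refl
sumTo-last (suc n) f f≡0 = begin
  sumTo n f + f (suc n) ≡⟨ cong (_+ f (suc n)) (sumTo-last n f (λ i i<n → f≡0 i (ℕ.m<n⇒m<1+n i<n))) ⟩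
  f n + f (suc n)       ≡⟨ cong (_+ f (suc n)) (f≡0 n ℕ.≤-refl) ⟩
  0ℤ + f (suc n)        ≡⟨ ℤ.+-identityˡ (f (suc n)) ⟩
  f (suc n)             ∎
  where open ≡-Reasoning

sumTo-split : ∀ p q f → sumTo (p ℕ.+ suc q) f ≡ sumTo p f + sumTo q (λ j → f (p ℕ.+ suc j))
sumTo-split p zero    f rewrite ℕ.+-suc p 0 | ℕ.+-identityʳ p = refl
sumTo-split p (suc q) f = begin
  sumTo (p ℕ.+ suc (suc q)) f
    ≡⟨ cong (λ m → sumTo m f) (ℕ.+-suc p (suc q)) ⟩
  sumTo (p ℕ.+ suc q) f + f (suc (p ℕ.+ suc q))
    ≡⟨ cong₂ _+_ (sumTo-split p q f) (cong f (sym (ℕ.+-suc p (suc q)))) ⟩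
  sumTo p f + sumTo q (λ j → f (p ℕ.+ suc j)) + f (p ℕ.+ suc (suc q))
    ≡⟨ ℤ.+-assoc (sumTo p f) _ _ ⟩
  sumTo p f + sumTo (suc q) (λ j → f (p ℕ.+ suc j)) ∎
  where open ≡-Reasoning

sumTo-reverse : ∀ n f → sumTo n f ≡ sumTo n (λ i → f (n ∸ i))
sumTo-reverse zero    f = refl
sumTo-reverse (suc n) f = begin
  sumTo (suc n) f                                    ≡⟨ sumTo-peel n f ⟩
  f 0 + sumTo n (f ∘ suc)                            ≡⟨ cong (_+_ (f 0)) (sumTo-reverse n (f ∘ suc)) ⟩
  f 0 + sumTo n (λ i → f (suc (n ∸ i)))              ≡⟨ cong (_+_ (f 0)) (sumTo-cong n λ i i≤n → cong f (sym (ℕ.+-∸-assoc 1 i≤n))) ⟩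
  f 0 + sumTo n (λ i → f (suc n ∸ i))                ≡⟨ ℤ.+-comm (f 0) _ ⟩
  sumTo n (λ i → f (suc n ∸ i)) + f 0                ≡⟨ cong (λ m → sumTo n (λ i → f (suc n ∸ i)) + f m) (sym (ℕ.n∸n≡0 n)) ⟩
  sumTo (suc n) (λ i → f (suc n ∸ i))                ∎
  where open ≡-Reasoning

⊛-comm : ∀ f g n → (f ⊛ g) n ≡ (g ⊛ f) n
⊛-comm f g n = begin
  sumTo n (λ i → f i * g (n ∸ i))               ≡⟨ sumTo-reverse n _ ⟩
  sumTo n (λ i → f (n ∸ i) * g (n ∸ (n ∸ i)))   ≡⟨ sumTo-cong n (λ i i≤n → cong (λ m → f (n ∸ i) * g m) (ℕ.m∸[m∸n]≡n i≤n)) ⟩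
  sumTo n (λ i → f (n ∸ i) * g i)               ≡⟨ sumTo-cong n (λ i _ → ℤ.*-comm (f (n ∸ i)) (g i)) ⟩
  sumTo n (λ i → g i * f (n ∸ i))               ∎
  where open ≡-Reasoning

⊛-cong₂ : ∀ n {f f′ g g′} → (∀ i → f i ≡₂ f′ i) → (∀ i → g i ≡₂ g′ i) → (f ⊛ g) n ≡₂ (f′ ⊛ g′) n
⊛-cong₂ n f≡₂f′ g≡₂g′ = sumTo-cong₂ n (λ i → *-cong₂ (f≡₂f′ i) (g≡₂g′ (n ∸ i)))

Gap : ℕ → Series → Set
Gap M g = ∀ j → 0 < j → j ≤ M → g j ≡ 0ℤ

⊛-gap-low : ∀ M {f g} n → Gap M g → n ≤ M → (f ⊛ g) n ≡ f n * g 0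
⊛-gap-low M {f} {g} n gap n≤M = begin
  sumTo n (λ i → f i * g (n ∸ i)) ≡⟨ sumTo-last n _ vanish ⟩
  f n * g (n ∸ n)                 ≡⟨ cong (λ m → f n * g m) (ℕ.n∸n≡0 n) ⟩
  f n * g 0                       ∎
  where
  open ≡-Reasoning
  vanish : ∀ i → i < n → f i * g (n ∸ i) ≡ 0ℤ
  vanish i i<n = trans (cong (f i *_) (gap (n ∸ i) (ℕ.m<n⇒0<n∸m i<n) (ℕ.≤-trans (ℕ.m∸n≤m n i) n≤M)))
                       (ℤ.*-zeroʳ (f i))

⊛-gap-high : ∀ M {f g h} p → Gap M g → (∀ x → g (x ℕ.+ suc M) ≡ h x) →
             (f ⊛ g) (p ℕ.+ suc M) ≡ f (p ℕ.+ suc M) * g 0 + (f ⊛ h) p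
⊛-gap-high M {f} {g} {h} p gap g≡h = begin
  sumTo (p ℕ.+ suc M) (λ i → f i * g (p ℕ.+ suc M ∸ i))
    ≡⟨ sumTo-split p M _ ⟩
  sumTo p (λ i → f i * g (p ℕ.+ suc M ∸ i)) + sumTo M (λ j → f (p ℕ.+ suc j) * g (p ℕ.+ suc M ∸ (p ℕ.+ suc j)))
    ≡⟨ cong₂ _+_ (sumTo-cong p shift) (sumTo-last M _ vanish) ⟩
  (f ⊛ h) p + f (p ℕ.+ suc M) * g (p ℕ.+ suc M ∸ (p ℕ.+ suc M))
    ≡⟨ cong (λ m → (f ⊛ h) p + f (p ℕ.+ suc M) * g m) (ℕ.n∸n≡0 (p ℕ.+ suc M)) ⟩
  (f ⊛ h) p + f (p ℕ.+ suc M) * g 0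
    ≡⟨ ℤ.+-comm ((f ⊛ h) p) _ ⟩
  f (p ℕ.+ suc M) * g 0 + (f ⊛ h) p ∎
  where
  open ≡-Reasoning
  shift : ∀ i → i ≤ p → f i * g (p ℕ.+ suc M ∸ i) ≡ f i * h (p ∸ i)
  shift i i≤p = cong (f i *_) (trans (cong g (ℕ.+-∸-comm (suc M) i≤p)) (g≡h (p ∸ i)))
  vanish : ∀ j → j < M → f (p ℕ.+ suc j) * g (p ℕ.+ suc M ∸ (p ℕ.+ suc j)) ≡ 0ℤ
  vanish j j<M = trans (cong (λ m → f (p ℕ.+ suc j) * g m) (ℕ.[m+n]∸[m+o]≡n∸o p (suc M) (suc j)))
    (trans (cong (f (p ℕ.+ suc j) *_) (gap (M ∸ j) (ℕ.m<n⇒0<n∸m j<M) (ℕ.m∸n≤m M j))) (ℤ.*-zeroʳ (f (p ℕ.+ suc j))))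

-- Dilation and binomial coefficients modulo 2

dilate : (m : ℕ) .{{_ : NonZero m}} → (ℕ → ℤ) → Series
dilate m f j = if j % m ≡ᵇ 0 then f (j / m) else 0ℤ

module _ {M : ℕ} where

  dilate-gap : ∀ f → Gap M (dilate (suc M) f)
  dilate-gap f (suc i) _ i<M rewrite m<n⇒m%n≡m (s≤s i<M) = refl

  dilate-shift : ∀ f x → dilate (suc M) f (x ℕ.+ suc M) ≡ dilate (suc M) (f ∘ suc) x
  dilate-shift f x rewrite [m+n]%n≡m%n x (suc M) ⦃ ℕ.nonZero ⦄
                         | m/n≡1+[m∸n]/n {x ℕ.+ suc M} {suc M} (ℕ.m≤n+m (suc M) x)
                         | ℕ.m+n∸n≡m x (suc M) = refl

  dilate-cong : ∀ {f g} → f ≗ g → dilate (suc M) f ≗ dilate (suc M) g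
  dilate-cong f≗g j with j % suc M ≡ᵇ 0
  ... | true  = f≗g (j / suc M)
  ... | false = refl

  dilate-cong₂ : ∀ {f g} → (∀ a → f a ≡₂ g a) → ∀ j → dilate (suc M) f j ≡₂ dilate (suc M) g j
  dilate-cong₂ f≡₂g j with j % suc M ≡ᵇ 0
  ... | true  = f≡₂g (j / suc M)
  ... | false = ≡₂-refl

  dilate-+ : ∀ f g j → dilate (suc M) (λ a → f a + g a) j ≡ dilate (suc M) f j + dilate (suc M) g j
  dilate-+ f g j with j % suc M ≡ᵇ 0
  ... | true  = refl
  ... | false = refl

  dilate-vanishing : ∀ {f} → (∀ a → f a ≡ 0ℤ) → ∀ j → dilate (suc M) f j ≡ 0ℤ
  dilate-vanishing f≡0 j with j % suc M ≡ᵇ 0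
  ... | true  = f≡0 (j / suc M)
  ... | false = refl

  dilate-low : ∀ f j → j ≤ M → dilate (suc M) f j ≡ f 0 * oneS j
  dilate-low f zero    _   = sym (ℤ.*-identityʳ (f 0))
  dilate-low f (suc i) i<M = trans (dilate-gap f (suc i) (s≤s z≤n) i<M) (sym (ℤ.*-zeroʳ (f 0)))

data Position (M : ℕ) : ℕ → Set where
  below  : ∀ {j} → j ≤ M → Position M j
  beyond : ∀ p → Position M (p ℕ.+ suc M)

position : ∀ M j → Position M j
position M j with j ℕ.≤? M
... | yes j≤M = below j≤M
... | no  j≰M = subst (Position M) (ℕ.m∸n+n≡m (ℕ.≰⇒> j≰M)) (beyond (j ∸ suc M))

oneMinusQ-other : ∀ {m n} → n ≢ 0 → n ≢ m → oneMinusQ m n ≡ 0ℤ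
oneMinusQ-other {m} {n} n≢0 n≢m with n ℕ.≟ 0 | n ℕ.≟ m
... | yes n≡0 | _       = contradiction n≡0 n≢0
... | no _    | yes n≡m = contradiction n≡m n≢m
... | no _    | no _    = refl

oneMinusQ-degree : ∀ M → oneMinusQ (suc M) (suc M) ≡ -1ℤ
oneMinusQ-degree M with suc M ℕ.≟ suc M
... | yes _     = refl
... | no  M≢M   = contradiction refl M≢M

oneMinusQ-gap : ∀ M → Gap M (oneMinusQ (suc M))
oneMinusQ-gap M j 0<j j≤M = oneMinusQ-other (ℕ.n>0⇒n≢0 0<j) (ℕ.<⇒≢ (s≤s j≤M))

oneMinusQ-shift : ∀ M x → oneMinusQ (suc M) (x ℕ.+ suc M) ≡ - oneS x
oneMinusQ-shift M zero    = oneMinusQ-degree M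
oneMinusQ-shift M (suc x) = oneMinusQ-other (λ ()) (ℕ.>⇒≢ (ℕ.m<n+m (suc M) {suc x} (s≤s z≤n)))

⊛-oneMinusQ-low : ∀ M f j → j ≤ M → (f ⊛ oneMinusQ (suc M)) j ≡ f j
⊛-oneMinusQ-low M f j j≤M = trans (⊛-gap-low M {f} j (oneMinusQ-gap M) j≤M) (ℤ.*-identityʳ (f j))

⊛-oneMinusQ-high : ∀ M f p → (f ⊛ oneMinusQ (suc M)) (p ℕ.+ suc M) ≡ f (p ℕ.+ suc M) - f p
⊛-oneMinusQ-high M f p = begin
  (f ⊛ oneMinusQ (suc M)) (p ℕ.+ suc M)          ≡⟨ ⊛-gap-high M {f} p (oneMinusQ-gap M) (oneMinusQ-shift M) ⟩
  f (p ℕ.+ suc M) * 1ℤ + (f ⊛ (-_ ∘ oneS)) p     ≡⟨ cong (_+_ (f (p ℕ.+ suc M) * 1ℤ)) (⊛-gap-low p {f} p negOneS-gap ℕ.≤-refl) ⟩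
  f (p ℕ.+ suc M) * 1ℤ + f p * -1ℤ               ≡⟨ simplify (f (p ℕ.+ suc M)) (f p) ⟩
  f (p ℕ.+ suc M) - f p                          ∎
  where
  open ≡-Reasoning
  negOneS-gap : Gap p (-_ ∘ oneS)
  negOneS-gap (suc _) _ _ = refl
  simplify : ∀ x y → x * 1ℤ + y * -1ℤ ≡ x - y
  simplify = solve-∀

pascal : ∀ e a → + (e C suc a) + + (e C a) ≡ + (suc e C suc a)
pascal e a = trans (sym (ℤ.pos-+ (e C suc a) (e C a)))
                   (cong +_ (trans (ℕ.+-comm (e C suc a) (e C a)) (nCk+nC[k+1]≡[n+1]C[k+1] e a)))

oneMinusQ^-parity : ∀ M e j → (oneMinusQ (suc M) ^S e) j ≡₂ dilate (suc M) (λ a → + (e C a)) j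
oneMinusQ^-parity M zero j = ≡⇒≡₂ (oneS-dilate (position M j))
  where
  oneS-dilate : ∀ {j} → Position M j → oneS j ≡ dilate (suc M) (λ a → + (0 C a)) j
  oneS-dilate {j} (below j≤M) = sym (trans (dilate-low (λ a → + (0 C a)) j j≤M) (ℤ.*-identityˡ (oneS j)))
  oneS-dilate (beyond p) =
    trans (cong oneS (ℕ.+-suc p M)) (sym (trans (dilate-shift (λ a → + (0 C a)) p) (dilate-vanishing (λ _ → refl) p)))
oneMinusQ^-parity M (suc e) j = ≡₂-trans (≡⇒≡₂ (⊛-comm O (O ^S e) j)) (multiply (position M j))
  where
  O = oneMinusQ (suc M)
  Cₑ : ℕ → ℤ
  Cₑ a = + (e C a)
  multiply : ∀ {j} → Position M j → ((O ^S e) ⊛ O) j ≡₂ dilate (suc M) (λ a → + (suc e C a)) j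
  multiply {j} (below j≤M) = begin
    ((O ^S e) ⊛ O) j                         ≡⟨ ⊛-oneMinusQ-low M (O ^S e) j j≤M ⟩
    (O ^S e) j                               ≈⟨ oneMinusQ^-parity M e j ⟩
    dilate (suc M) Cₑ j                      ≡⟨ trans (dilate-low Cₑ j j≤M) (sym (dilate-low (λ a → + (suc e C a)) j j≤M)) ⟩
    dilate (suc M) (λ a → + (suc e C a)) j   ∎
    where open ≡₂-Reasoning
  multiply (beyond p) = begin
    ((O ^S e) ⊛ O) (p ℕ.+ suc M)                          ≡⟨ ⊛-oneMinusQ-high M (O ^S e) p ⟩
    (O ^S e) (p ℕ.+ suc M) - (O ^S e) p                   ≈⟨ -≡₂+ ((O ^S e) (p ℕ.+ suc M)) ((O ^S e) p) ⟩
    (O ^S e) (p ℕ.+ suc M) + (O ^S e) p                   ≈⟨ +-cong₂ (oneMinusQ^-parity M e _) (oneMinusQ^-parity M e p) ⟩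
    dilate (suc M) Cₑ (p ℕ.+ suc M) + dilate (suc M) Cₑ p ≡⟨ cong (_+ dilate (suc M) Cₑ p) (dilate-shift Cₑ p) ⟩
    dilate (suc M) (Cₑ ∘ suc) p + dilate (suc M) Cₑ p     ≡⟨ sym (dilate-+ (Cₑ ∘ suc) Cₑ p) ⟩
    dilate (suc M) (λ a → Cₑ (suc a) + Cₑ a) p            ≡⟨ dilate-cong (pascal e) p ⟩
    dilate (suc M) (λ a → + (suc e C suc a)) p            ≡⟨ sym (dilate-shift (λ a → + (suc e C a)) p) ⟩
    dilate (suc M) (λ a → + (suc e C a)) (p ℕ.+ suc M)    ∎
    where open ≡₂-Reasoning

%2≢1⇒%2≡0 : ∀ n → n % 2 ≢ 1 → n % 2 ≡ 0
%2≢1⇒%2≡0 n ≢1 with n % 2 | m%n<n n 2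
... | 0           | _               = refl
... | 1           | _               = contradiction refl ≢1
... | suc (suc _) | s≤s (s≤s ())

𝟙-inA≡%2 : ∀ k a → 𝟙 (inA? k a) ≡ + ((k C a) % 2)
𝟙-inA≡%2 k a with inA? k a
... | yes (_ , odd) = cong +_ (sym odd)
... | no ¬inA       = cong +_ (sym even)
  where
  even : (k C a) % 2 ≡ 0
  even with a ℕ.≤? k
  ... | yes a≤k = %2≢1⇒%2≡0 (k C a) (λ odd → ¬inA (a≤k , odd))
  ... | no  a≰k = cong (_% 2) (k>n⇒nCk≡0 (ℕ.≰⇒> a≰k))

binomial-parity : ∀ k a → + (k C a) ≡₂ 𝟙 (inA? k a)
binomial-parity k a = ≡₂-trans (≡₂-%2 (k C a)) (≡⇒≡₂ (sym (𝟙-inA≡%2 k a)))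

module FrequencySeries {P : Pred ℕ 0ℓ} (P? : Decidable P) where

  -- Σ { q^(m a) ∣ c + a ∈ P }: the choices for further parts m once c of them are placed.
  factorFrom : (m : ℕ) .{{_ : NonZero m}} → ℕ → Series
  factorFrom m c = dilate m (λ a → 𝟙 (P? (c ℕ.+ a)))

  freqProduct : ℕ → Series
  freqProduct zero    = oneS
  freqProduct (suc N) = freqProduct N ⊛ factorFrom (suc N) 0

  factorFrom-zero : ∀ M c → factorFrom (suc M) c 0 ≡ 𝟙 (P? c)
  factorFrom-zero M c = cong (𝟙 ∘ P?) (ℕ.+-identityʳ c)

  factorFrom-shift : ∀ M c x → factorFrom (suc M) c (x ℕ.+ suc M) ≡ factorFrom (suc M) (suc c) x
  factorFrom-shift M c x =
    trans (dilate-shift (λ a → 𝟙 (P? (c ℕ.+ a))) x) (dilate-cong (λ a → cong (𝟙 ∘ P?) (ℕ.+-suc c a)) x)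

module _ (k : ℕ) where
  open FrequencySeries (inA? k)

  oneMinusQ^k-parity : ∀ M j → (oneMinusQ (suc M) ^S k) j ≡₂ factorFrom (suc M) 0 j
  oneMinusQ^k-parity M j = ≡₂-trans (oneMinusQ^-parity M k j) (dilate-cong₂ (binomial-parity k) j)

  prodUpTo≡₂freqProduct : ∀ N n → prodUpTo k N n ≡₂ freqProduct N n
  prodUpTo≡₂freqProduct zero    n = ≡₂-refl
  prodUpTo≡₂freqProduct (suc N) n = ⊛-cong₂ n (prodUpTo≡₂freqProduct N) (oneMinusQ^k-parity N)

-- Counting partitions by frequencies

count : ∀ {a p} {A : Set a} {P : Pred A p} → Decidable P → List A → ℕ
count P? = length ∘ filter P?

module _ {a p} {A : Set a} {P : Pred A p} (P? : Decidable P) where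

  count-++ : ∀ xs ys → count P? (xs ++ ys) ≡ count P? xs ℕ.+ count P? ys
  count-++ xs ys = trans (cong length (filter-++ P? xs ys)) (length-++ (filter P? xs))

  count-singleton : ∀ x → + count P? (x ∷ []) ≡ 𝟙 (P? x)
  count-singleton x with P? x
  ... | yes _ = refl
  ... | no  _ = refl

  count-map : ∀ {b} {B : Set b} (f : B → A) xs → count P? (map f xs) ≡ count (P? ∘ f) xs
  count-map f []       = refl
  count-map f (x ∷ xs) with does (P? (f x))
  ... | true  = cong suc (count-map f xs)
  ... | false = count-map f xs

  count-≗ : ∀ {b} {B : Set b} {h h′ : B → A} → h ≗ h′ → ∀ xs → count (P? ∘ h) xs ≡ count (P? ∘ h′) xs
  count-≗ h≗h′ xs = cong length (filter-≐ (P? ∘ _) (P? ∘ _) ((λ {x} → subst P (h≗h′ x)) , (λ {x} → subst P (sym (h≗h′ x)))) xs)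

freq-++ : ∀ x xs ys → freq x (xs ++ ys) ≡ freq x xs ℕ.+ freq x ys
freq-++ x []       ys = refl
freq-++ x (y ∷ xs) ys with x ℕ.≟ y
... | yes _ = cong suc (freq-++ x xs ys)
... | no  _ = freq-++ x xs ys

freq-replicate-≡ : ∀ x c → freq x (replicate c x) ≡ c
freq-replicate-≡ x zero    = refl
freq-replicate-≡ x (suc c) with x ℕ.≟ x
... | yes _   = cong suc (freq-replicate-≡ x c)
... | no  x≢x = contradiction refl x≢x

freq-replicate-≢ : ∀ {x y} c → x ≢ y → freq x (replicate c y) ≡ 0
freq-replicate-≢         zero    _   = refl
freq-replicate-≢ {x} {y} (suc c) x≢y with x ℕ.≟ y
... | yes x≡y = contradiction x≡y x≢y
... | no  _   = freq-replicate-≢ c x≢y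

freq-∉ : ∀ {x} xs → x ∉ xs → freq x xs ≡ 0
freq-∉     []       _      = refl
freq-∉ {x} (y ∷ xs) x∉y∷xs with x ℕ.≟ y
... | yes x≡y = contradiction (here x≡y) x∉y∷xs
... | no  _   = freq-∉ xs (x∉y∷xs ∘ there)

freq-run-≡ : ∀ {m} ρ c → m ∉ ρ → freq m (ρ ++ replicate c m) ≡ c
freq-run-≡ {m} ρ c m∉ρ = trans (freq-++ m ρ _) (cong₂ ℕ._+_ (freq-∉ ρ m∉ρ) (freq-replicate-≡ m c))

freq-run-≢ : ∀ {x m} ρ c → x ≢ m → freq x (ρ ++ replicate c m) ≡ freq x ρ
freq-run-≢ {x} ρ c x≢m =
  trans (freq-++ x ρ _) (trans (cong (freq x ρ ℕ.+_) (freq-replicate-≢ c x≢m)) (ℕ.+-identityʳ (freq x ρ)))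

All<⇒∉ : ∀ {m ρ} → All (m <_) ρ → m ∉ ρ
All<⇒∉ m<ρ m∈ρ = ℕ.<-irrefl refl (All.lookup m<ρ m∈ρ)

All<-run : ∀ {N ρ} c → All (suc N <_) ρ → All (N <_) (ρ ++ replicate c (suc N))
All<-run {N} c sucN<ρ = All.++⁺ (All.map ℕ.<⇒≤ sucN<ρ) (All.replicate⁺ c (ℕ.n<1+n N))

run-extend : ∀ {a} {A : Set a} (ρ : List A) c m l → (ρ ++ replicate c m) ++ m ∷ l ≡ (ρ ++ replicate (suc c) m) ++ l
run-extend ρ c m l = begin
  (ρ ++ replicate c m) ++ m ∷ l     ≡⟨ ++-assoc ρ (replicate c m) (m ∷ l) ⟩
  ρ ++ replicate c m ++ m ∷ l       ≡⟨ cong (ρ ++_) (replicate-∷ c) ⟩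
  ρ ++ replicate (suc c) m ++ l     ≡⟨ ++-assoc ρ (replicate (suc c) m) l ⟨
  (ρ ++ replicate (suc c) m) ++ l   ∎
  where
  open ≡-Reasoning
  replicate-∷ : ∀ c → replicate c m ++ m ∷ l ≡ m ∷ replicate c m ++ l
  replicate-∷ zero    = refl
  replicate-∷ (suc c) = cong (m ∷_) (replicate-∷ c)

module _ (f n : ℕ) where

  private
    firstPart : ℕ → List (List ℕ)
    firstPart p = map (p ∷_) (partsBounded f (suc n ∸ p) p)

  partsBounded-top : ∀ N → N ≤ n → partsBounded (suc f) (suc n) (suc N)
                   ≡ partsBounded (suc f) (suc n) N ++ map (suc N ∷_) (partsBounded f (n ∸ N) (suc N))
  partsBounded-top N N≤n = begin
    concatMap firstPart (range1 (suc N ⊓ suc n))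
      ≡⟨ cong (concatMap firstPart ∘ range1 ∘ suc) (ℕ.m≤n⇒m⊓n≡m N≤n) ⟩
    concatMap firstPart (range1 N ++ suc N ∷ [])
      ≡⟨ concatMap-++ firstPart (range1 N) (suc N ∷ []) ⟩
    concatMap firstPart (range1 N) ++ firstPart (suc N) ++ []
      ≡⟨ cong₂ _++_ (cong (concatMap firstPart ∘ range1) (sym (ℕ.m≤n⇒m⊓n≡m (ℕ.m≤n⇒m≤1+n N≤n)))) (++-identityʳ _) ⟩
    concatMap firstPart (range1 (N ⊓ suc n)) ++ firstPart (suc N) ∎
    where open ≡-Reasoning

  partsBounded-saturated : ∀ N → n < N → partsBounded (suc f) (suc n) (suc N) ≡ partsBounded (suc f) (suc n) N
  partsBounded-saturated N n<N =
    cong (concatMap firstPart ∘ range1) (trans (ℕ.m≥n⇒m⊓n≡n (ℕ.m≤n⇒m≤1+n n<N)) (sym (ℕ.m≥n⇒m⊓n≡n n<N)))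

module FrequencyCounting {P : Pred ℕ 0ℓ} (P? : Decidable P) (P0 : P 0) where
  open FrequencySeries P?

  AllFreqs : List ℕ → Set
  AllFreqs l = All (λ x → P (freq x l)) l

  allFreqs? : Decidable AllFreqs
  allFreqs? l = all? (λ x → P? (freq x l)) l

  -- P 0 lets absent parts be treated as having an admissible frequency.
  allFreqs⇔ : ∀ l → AllFreqs l ⇔ (∀ x → P (freq x l))
  allFreqs⇔ l = mk⇔ (λ allFreqs x → atEvery allFreqs x (x ∈? l)) (λ P-freq → All.tabulate (λ {x} _ → P-freq x))
    where
    atEvery : AllFreqs l → ∀ x → Dec (x ∈ l) → P (freq x l)
    atEvery allFreqs x (yes x∈l) = All.lookup allFreqs x∈l
    atEvery allFreqs x (no  x∉l) = subst P (sym (freq-∉ l x∉l)) P0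

  allFreqs-run : ∀ {m} ρ c → m ∉ ρ → AllFreqs (ρ ++ replicate c m) ⇔ (AllFreqs ρ × P c)
  allFreqs-run {m} ρ c m∉ρ = mk⇔
    (λ allFreqs → let P-freq = Equivalence.to (allFreqs⇔ run) allFreqs in
      Equivalence.from (allFreqs⇔ ρ) (λ x → before P-freq x (x ℕ.≟ m)) , subst P (freq-run-≡ ρ c m∉ρ) (P-freq m))
    (λ (allFreqsρ , Pc) → Equivalence.from (allFreqs⇔ run)
      (λ x → after (Equivalence.to (allFreqs⇔ ρ) allFreqsρ) Pc x (x ℕ.≟ m)))
    where
    run = ρ ++ replicate c m
    before : (∀ x → P (freq x run)) → ∀ x → Dec (x ≡ m) → P (freq x ρ)
    before _      x (yes refl) = subst P (sym (freq-∉ ρ m∉ρ)) P0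
    before P-freq x (no  x≢m)  = subst P (freq-run-≢ ρ c x≢m) (P-freq x)
    after : (∀ x → P (freq x ρ)) → P c → ∀ x → Dec (x ≡ m) → P (freq x run)
    after _      Pc x (yes refl) = subst P (sym (freq-run-≡ ρ c m∉ρ)) Pc
    after P-freq _  x (no  x≢m)  = subst P (sym (freq-run-≢ ρ c x≢m)) (P-freq x)

  𝟙-allFreqs-run : ∀ {m} ρ c → m ∉ ρ → 𝟙 (allFreqs? (ρ ++ replicate c m)) ≡ 𝟙 (allFreqs? ρ) * 𝟙 (P? c)
  𝟙-allFreqs-run ρ c m∉ρ = 𝟙-× (allFreqs-run ρ c m∉ρ) (allFreqs? _) (allFreqs? ρ) (P? c)

  freqProduct-zero : ∀ N → freqProduct N 0 ≡ 1ℤ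
  freqProduct-zero zero    = refl
  freqProduct-zero (suc N) = cong₂ _*_ (freqProduct-zero N) (𝟙-yes P0 (P? 0))

  runSeries : ℕ → ℕ → Series
  runSeries N c = freqProduct N ⊛ factorFrom (suc N) c

  runSeries-low : ∀ N c n → n ≤ N → runSeries N c n ≡ 𝟙 (P? c) * freqProduct N n
  runSeries-low N c n n≤N = begin
    runSeries N c n                        ≡⟨ ⊛-gap-low N {freqProduct N} {factorFrom (suc N) c} n (dilate-gap (λ a → 𝟙 (P? (c ℕ.+ a)))) n≤N ⟩
    freqProduct N n * factorFrom (suc N) c 0 ≡⟨ cong (freqProduct N n *_) (factorFrom-zero N c) ⟩
    freqProduct N n * 𝟙 (P? c)             ≡⟨ ℤ.*-comm (freqProduct N n) (𝟙 (P? c)) ⟩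
    𝟙 (P? c) * freqProduct N n             ∎
    where open ≡-Reasoning

  runSeries-high : ∀ N c n → N ≤ n →
    runSeries N c (suc n) ≡ 𝟙 (P? c) * freqProduct N (suc n) + runSeries N (suc c) (n ∸ N)
  runSeries-high N c n N≤n = begin
    runSeries N c (suc n)
      ≡⟨ cong (runSeries N c) (sym split) ⟩
    runSeries N c (n ∸ N ℕ.+ suc N)
      ≡⟨ ⊛-gap-high N {freqProduct N} {factorFrom (suc N) c} (n ∸ N) (dilate-gap (λ a → 𝟙 (P? (c ℕ.+ a)))) (factorFrom-shift N c) ⟩
    freqProduct N (n ∸ N ℕ.+ suc N) * factorFrom (suc N) c 0 + runSeries N (suc c) (n ∸ N)
      ≡⟨ cong₂ (λ j z → freqProduct N j * z + runSeries N (suc c) (n ∸ N)) split (factorFrom-zero N c) ⟩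
    freqProduct N (suc n) * 𝟙 (P? c) + runSeries N (suc c) (n ∸ N)
      ≡⟨ cong (_+ runSeries N (suc c) (n ∸ N)) (ℤ.*-comm (freqProduct N (suc n)) (𝟙 (P? c))) ⟩
    𝟙 (P? c) * freqProduct N (suc n) + runSeries N (suc c) (n ∸ N) ∎
    where
    open ≡-Reasoning
    split : n ∸ N ℕ.+ suc N ≡ suc n
    split = trans (ℕ.+-suc (n ∸ N) N) (cong suc (ℕ.m∸n+n≡m N≤n))

  completions : (fuel n bound : ℕ) → List ℕ → ℕ
  completions f n m ρ = count (allFreqs? ∘ (ρ ++_)) (partsBounded f n m)

  completions-zero : ∀ f m ρ → + completions f 0 m ρ ≡ 𝟙 (allFreqs? ρ)
  completions-zero f m ρ = trans (count-singleton (allFreqs? ∘ (ρ ++_)) []) (cong (𝟙 ∘ allFreqs?) (++-identityʳ ρ))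

  completions-top : ∀ f n N ρ c → N ≤ n →
    completions (suc f) (suc n) (suc N) (ρ ++ replicate c (suc N))
    ≡ completions (suc f) (suc n) N (ρ ++ replicate c (suc N)) ℕ.+ completions f (n ∸ N) (suc N) (ρ ++ replicate (suc c) (suc N))
  completions-top f n N ρ c N≤n = begin
    count good (partsBounded (suc f) (suc n) (suc N))        ≡⟨ cong (count good) (partsBounded-top f n N N≤n) ⟩
    count good (lower ++ map (suc N ∷_) upper)               ≡⟨ count-++ good lower (map (suc N ∷_) upper) ⟩
    count good lower ℕ.+ count good (map (suc N ∷_) upper)   ≡⟨ cong (count good lower ℕ.+_) (count-map good (suc N ∷_) upper) ⟩
    count good lower ℕ.+ count (good ∘ (suc N ∷_)) upper     ≡⟨ cong (count good lower ℕ.+_) (count-≗ allFreqs? (run-extend ρ c (suc N)) upper) ⟩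
    count good lower ℕ.+ completions f (n ∸ N) (suc N) (ρ ++ replicate (suc c) (suc N)) ∎
    where
    open ≡-Reasoning
    good  = allFreqs? ∘ ((ρ ++ replicate c (suc N)) ++_)
    lower = partsBounded (suc f) (suc n) N
    upper = partsBounded f (n ∸ N) (suc N)

  𝟙-allFreqs-run-* : ∀ N ρ c x → All (suc N <_) ρ →
    𝟙 (allFreqs? (ρ ++ replicate c (suc N))) * x ≡ 𝟙 (allFreqs? ρ) * (𝟙 (P? c) * x)
  𝟙-allFreqs-run-* N ρ c x ρ>N =
    trans (cong (_* x) (𝟙-allFreqs-run ρ c (All<⇒∉ ρ>N))) (ℤ.*-assoc (𝟙 (allFreqs? ρ)) (𝟙 (P? c)) x)

  runSeries-zero : ∀ N c → runSeries N c 0 ≡ 𝟙 (P? c)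
  runSeries-zero N c = trans (runSeries-low N c 0 z≤n)
                             (trans (cong (𝟙 (P? c) *_) (freqProduct-zero N)) (ℤ.*-identityʳ (𝟙 (P? c))))

  -- ρ holds the parts larger than suc N chosen so far, followed by c parts equal to suc N.
  completions-run : ∀ f n → n ≤ f → ∀ N ρ c → All (suc N <_) ρ →
    + completions f n (suc N) (ρ ++ replicate c (suc N)) ≡ 𝟙 (allFreqs? ρ) * runSeries N c n
  completions-below : ∀ f n → n ≤ f → ∀ N ρ → All (N <_) ρ →
    + completions f n N ρ ≡ 𝟙 (allFreqs? ρ) * freqProduct N n

  completions-run f zero _ N ρ c ρ>N = begin
    + completions f 0 (suc N) (ρ ++ replicate c (suc N)) ≡⟨ completions-zero f (suc N) _ ⟩
    𝟙 (allFreqs? (ρ ++ replicate c (suc N)))           ≡⟨ 𝟙-allFreqs-run ρ c (All<⇒∉ ρ>N) ⟩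
    𝟙 (allFreqs? ρ) * 𝟙 (P? c)                          ≡⟨ cong (𝟙 (allFreqs? ρ) *_) (runSeries-zero N c) ⟨
    𝟙 (allFreqs? ρ) * runSeries N c 0                   ∎
    where open ≡-Reasoning
  completions-run (suc f) (suc n) (s≤s n≤f) N ρ c ρ>N with N ℕ.≤? n
  ... | yes N≤n = begin
    + completions (suc f) (suc n) (suc N) run
      ≡⟨ cong +_ (completions-top f n N ρ c N≤n) ⟩
    + (completions (suc f) (suc n) N run ℕ.+ completions f (n ∸ N) (suc N) (ρ ++ replicate (suc c) (suc N)))
      ≡⟨ ℤ.pos-+ (completions (suc f) (suc n) N run) _ ⟩
    + completions (suc f) (suc n) N run + + completions f (n ∸ N) (suc N) (ρ ++ replicate (suc c) (suc N))
      ≡⟨ cong₂ _+_ (completions-below (suc f) (suc n) (s≤s n≤f) N run (All<-run c ρ>N))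
                   (completions-run f (n ∸ N) (ℕ.≤-trans (ℕ.m∸n≤m n N) n≤f) N ρ (suc c) ρ>N) ⟩
    𝟙 (allFreqs? run) * freqProduct N (suc n) + 𝟙 (allFreqs? ρ) * runSeries N (suc c) (n ∸ N)
      ≡⟨ cong (_+ 𝟙 (allFreqs? ρ) * runSeries N (suc c) (n ∸ N)) (𝟙-allFreqs-run-* N ρ c _ ρ>N) ⟩
    𝟙 (allFreqs? ρ) * (𝟙 (P? c) * freqProduct N (suc n)) + 𝟙 (allFreqs? ρ) * runSeries N (suc c) (n ∸ N)
      ≡⟨ ℤ.*-distribˡ-+ (𝟙 (allFreqs? ρ)) _ _ ⟨
    𝟙 (allFreqs? ρ) * (𝟙 (P? c) * freqProduct N (suc n) + runSeries N (suc c) (n ∸ N))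
      ≡⟨ cong (𝟙 (allFreqs? ρ) *_) (runSeries-high N c n N≤n) ⟨
    𝟙 (allFreqs? ρ) * runSeries N c (suc n) ∎
    where
    open ≡-Reasoning
    run = ρ ++ replicate c (suc N)
  ... | no N≰n = begin
    + completions (suc f) (suc n) (suc N) run
      ≡⟨ cong (λ xs → + count (allFreqs? ∘ (run ++_)) xs) (partsBounded-saturated f n N (ℕ.≰⇒> N≰n)) ⟩
    + completions (suc f) (suc n) N run
      ≡⟨ completions-below (suc f) (suc n) (s≤s n≤f) N run (All<-run c ρ>N) ⟩
    𝟙 (allFreqs? run) * freqProduct N (suc n)
      ≡⟨ 𝟙-allFreqs-run-* N ρ c _ ρ>N ⟩
    𝟙 (allFreqs? ρ) * (𝟙 (P? c) * freqProduct N (suc n))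
      ≡⟨ cong (𝟙 (allFreqs? ρ) *_) (runSeries-low N c (suc n) (ℕ.≰⇒> N≰n)) ⟨
    𝟙 (allFreqs? ρ) * runSeries N c (suc n) ∎
    where
    open ≡-Reasoning
    run = ρ ++ replicate c (suc N)

  completions-below f       zero    _   N       ρ _   =
    trans (completions-zero f N ρ)
          (sym (trans (cong (𝟙 (allFreqs? ρ) *_) (freqProduct-zero N)) (ℤ.*-identityʳ (𝟙 (allFreqs? ρ)))))
  completions-below (suc f) (suc n) _   zero    ρ _   = sym (ℤ.*-zeroʳ (𝟙 (allFreqs? ρ)))
  completions-below f       (suc n) n≤f (suc N) ρ ρ>N =
    trans (cong (+_ ∘ completions f (suc n) (suc N)) (sym (++-identityʳ ρ))) (completions-run f (suc n) n≤f N ρ 0 ρ>N)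

  partitionCount : ∀ n → + count allFreqs? (partitions n) ≡ freqProduct n n
  partitionCount n = trans (completions-below n n ℕ.≤-refl n [] All.[]) (ℤ.*-identityˡ (freqProduct n n))

mainTheorem5 : (k : ℕ) → 1 ≤ k → (n : ℕ) → 1 ≤ n →
    (+ 2) ∣ (tau k (Data.Nat.suc n) - (+ F k n))
-- The congruence holds for every k and n.
mainTheorem5 k _ n _ = Signed.∣⇒∣ᵤ (2∣x-y (≡₂-trans (prodUpTo≡₂freqProduct k n n) (≡⇒≡₂ (sym (partitionCount n)))))
  where open FrequencyCounting (inA? k) (z≤n , refl)
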